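{- For all $\alpha,\beta,\gamma,\delta\in\Omega$ and all $k,l\in\mathbb{N}$, if $\alpha+\phi_k(\beta)=\gamma+\phi_l(\delta)$ then $k=l$, $\alpha=\gamma$ and $\beta=\delta$.
   Context: Constructive ordinals: $\Omega$ is the set of infinitary terms generated by $0$, successor $\alpha+1$, and limits $\langle\alpha_i\rangle_{i\in\mathbb{N}}$; equality is syntactic equality of these well-founded trees (a limit is equal to another limit iff their sequences agree termwise). $o(0)=0$, $o(n+1)=o(n)+1$, $\omega=\langle o(i+1)\rangle_i$. Arithmetic: $\alpha+0=\alpha$, $\alpha+(\beta+1)=(\alpha+\beta)+1$, $\alpha+\langle\beta_i\rangle=\langle\alpha+\beta_i\rangle$; $\alpha\cdot0=0$, $\alpha\cdot(\beta+1)=\alpha\cdot\beta+\alpha$, $\alpha\cdot\langle\beta_i\rangle=\langle\alpha\cdot\beta_i\rangle$; $\alpha^0=o(1)$, $\alpha^{\beta+1}=\alpha^\beta\cdot\alpha$, $\alpha^{\langle\beta_i\rangle}=\langle\alpha^{\beta_i}\rangle$. Constructive Veblen functions: $\phi_0(\gamma)=\omega^\gamma$; $\phi_{k+1}(0)=\langle\phi_k^{(i)}(0)\rangle_i$; $\phi_{k+1}(\gamma+1)=\langle\phi_k^{(i)}(\phi_{k+1}(\gamma)+1)\rangle_i$; $\phi_{k+1}(\langle\gamma_i\rangle)=\langle\phi_{k+1}(\gamma_i)\rangle_i$ ($\phi_k^{(i)}$ the $i$-fold iterate). -}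

module Defs where

open import Data.Nat using (ℕ; zero; suc)

data Ω : Set where
  𝟎   : Ω
  _⁺  : Ω → Ω
  lim : (ℕ → Ω) → Ω

o : ℕ → Ω
o zero    = 𝟎
o (suc n) = (o n) ⁺

ω : Ω
ω = lim (λ i → o (suc i))

infixl 6 _⊕_
infixl 7 _⊗_

_⊕_ : Ω → Ω → Ω
α ⊕ 𝟎       = α
α ⊕ (β ⁺)   = (α ⊕ β) ⁺
α ⊕ lim f   = lim (λ i → α ⊕ f i)

_⊗_ : Ω → Ω → Ω
α ⊗ 𝟎       = 𝟎
α ⊗ (β ⁺)   = (α ⊗ β) ⊕ α
α ⊗ lim f   = lim (λ i → α ⊗ f i)

_^_ : Ω → Ω → Ω
α ^ 𝟎       = o 1
α ^ (β ⁺)   = (α ^ β) ⊗ α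
α ^ lim f   = lim (λ i → α ^ f i)

iter : (Ω → Ω) → ℕ → Ω → Ω
iter f zero    x = x
iter f (suc i) x = f (iter f i x)

φ : ℕ → Ω → Ω
φ zero    γ       = ω ^ γ
φ (suc k) 𝟎       = lim (λ i → iter (φ k) i 𝟎)
φ (suc k) (γ ⁺)   = lim (λ i → iter (φ k) i ((φ (suc k) γ) ⁺))
φ (suc k) (lim g) = lim (λ i → φ (suc k) (g i))

-- Syntactic equality of constructive ordinals: limits are equal iff their
-- sequences agree termwise (as in the paper; avoids needing funext).
infix 4 _≈_
data _≈_ : Ω → Ω → Set where
  𝟎≈   : 𝟎 ≈ 𝟎
  ⁺≈   : ∀ {α β} → α ≈ β → (α ⁺) ≈ (β ⁺)
  lim≈ : ∀ {f g} → (∀ i → f i ≈ g i) → lim f ≈ lim g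

-- A Veblen sum α + φ_k β is α + 1 when k = β = 0, and otherwise a limit whose fundamental
-- sequence consists of smaller Veblen sums: (α + ω^β'·i) + ω^β' when k = 0 and β = β' + 1,
-- α + φ_k β_i when β = lim β_i, and α + φ_{k-1} ξ_i for the iterates ξ_i when k > 0 (apart
-- from the entry 0, which is α or (α + φ_k β') + 1).  Comparing two equal sums entrywise,
-- induction on (k, β) identifies the components.  When the shapes differ, the first two
-- entries yield α ≈ γ + A and α + B ≈ γ with B ≠ 0, impossible because the length of the
-- leftmost branch of a tree is additive under +.
module Submission where

open import Defs
open import Data.Nat using (ℕ; zero; suc; _+_)
open import Data.Nat.Properties using (+-assoc; +-cancelʳ-≡; m+n≡0⇒m≡0)
open import Data.Product using (_×_; _,_)
open import Relation.Binary.PropositionalEquality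
  using (_≡_; _≢_; refl; cong; module ≡-Reasoning)

≈-refl : ∀ α → α ≈ α
≈-refl 𝟎       = 𝟎≈
≈-refl (α ⁺)   = ⁺≈ (≈-refl α)
≈-refl (lim f) = lim≈ (λ i → ≈-refl (f i))

≈-sym : ∀ {α β} → α ≈ β → β ≈ α
≈-sym 𝟎≈       = 𝟎≈
≈-sym (⁺≈ p)   = ⁺≈ (≈-sym p)
≈-sym (lim≈ p) = lim≈ (λ i → ≈-sym (p i))

≈-trans : ∀ {α β γ} → α ≈ β → β ≈ γ → α ≈ γ
≈-trans 𝟎≈       𝟎≈       = 𝟎≈
≈-trans (⁺≈ p)   (⁺≈ q)   = ⁺≈ (≈-trans p q)
≈-trans (lim≈ p) (lim≈ q) = lim≈ (λ i → ≈-trans (p i) (q i))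

⁺-injective : ∀ {α β} → α ⁺ ≈ β ⁺ → α ≈ β
⁺-injective (⁺≈ p) = p

lim-injective : ∀ {f g} → lim f ≈ lim g → ∀ i → f i ≈ g i
lim-injective (lim≈ p) = p

≈𝟎⇒≡𝟎 : ∀ {α} → α ≈ 𝟎 → α ≡ 𝟎
≈𝟎⇒≡𝟎 𝟎≈ = refl

⊕-assoc : ∀ α β γ → α ⊕ (β ⊕ γ) ≈ (α ⊕ β) ⊕ γ
⊕-assoc α β 𝟎       = ≈-refl (α ⊕ β)
⊕-assoc α β (γ ⁺)   = ⁺≈ (⊕-assoc α β γ)
⊕-assoc α β (lim f) = lim≈ (λ i → ⊕-assoc α β (f i))

⊕≡𝟎⇒≡𝟎 : ∀ α β → α ⊕ β ≡ 𝟎 → β ≡ 𝟎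
⊕≡𝟎⇒≡𝟎 α 𝟎 _ = refl

φ≢𝟎 : ∀ k β → φ k β ≢ 𝟎
φ≢𝟎 zero    𝟎       ()
φ≢𝟎 zero    (β ⁺)   ()
φ≢𝟎 zero    (lim f) ()
φ≢𝟎 (suc k) 𝟎       ()
φ≢𝟎 (suc k) (β ⁺)   ()
φ≢𝟎 (suc k) (lim f) ()

leftDepth : Ω → ℕ
leftDepth 𝟎       = 0
leftDepth (α ⁺)   = suc (leftDepth α)
leftDepth (lim f) = suc (leftDepth (f 0))

leftDepth-cong : ∀ {α β} → α ≈ β → leftDepth α ≡ leftDepth β
leftDepth-cong 𝟎≈       = refl
leftDepth-cong (⁺≈ p)   = cong suc (leftDepth-cong p)
leftDepth-cong (lim≈ p) = cong suc (leftDepth-cong (p 0))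

leftDepth-⊕ : ∀ α β → leftDepth (α ⊕ β) ≡ leftDepth β + leftDepth α
leftDepth-⊕ α 𝟎       = refl
leftDepth-⊕ α (β ⁺)   = cong suc (leftDepth-⊕ α β)
leftDepth-⊕ α (lim f) = cong suc (leftDepth-⊕ α (f 0))

leftDepth≡0⇒≡𝟎 : ∀ α → leftDepth α ≡ 0 → α ≡ 𝟎
leftDepth≡0⇒≡𝟎 𝟎 _ = refl

⊕-cycle⇒≡𝟎 : ∀ {α γ} A B → α ≈ γ ⊕ A → α ⊕ B ≈ γ → B ≡ 𝟎
⊕-cycle⇒≡𝟎 {α} {γ} A B α≈γ⊕A α⊕B≈γ =
  leftDepth≡0⇒≡𝟎 B (m+n≡0⇒m≡0 (leftDepth B) (+-cancelʳ-≡ (leftDepth γ) _ 0 depths))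
  where
  open ≡-Reasoning
  depths : leftDepth B + leftDepth A + leftDepth γ ≡ 0 + leftDepth γ
  depths = begin
    leftDepth B + leftDepth A + leftDepth γ   ≡⟨ +-assoc (leftDepth B) _ _ ⟩
    leftDepth B + (leftDepth A + leftDepth γ) ≡⟨ cong (leftDepth B +_) (leftDepth-⊕ γ A) ⟨
    leftDepth B + leftDepth (γ ⊕ A)           ≡⟨ cong (leftDepth B +_) (leftDepth-cong α≈γ⊕A) ⟨
    leftDepth B + leftDepth α                 ≡⟨ leftDepth-⊕ α B ⟨
    leftDepth (α ⊕ B)                         ≡⟨ leftDepth-cong α⊕B≈γ ⟩
    leftDepth γ                               ∎

φ₀⁺-entry : ∀ α β i → α ⊕ ω ^ β ⊗ o (suc i) ≈ (α ⊕ ω ^ β ⊗ o i) ⊕ φ 0 β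
φ₀⁺-entry α β i = ⊕-assoc α (ω ^ β ⊗ o i) (ω ^ β)

φ₀⁺-entryˡ : ∀ α β {g} → α ⊕ φ 0 (β ⁺) ≈ lim g → ∀ i → (α ⊕ ω ^ β ⊗ o i) ⊕ φ 0 β ≈ g i
φ₀⁺-entryˡ α β eq i = ≈-trans (≈-sym (φ₀⁺-entry α β i)) (lim-injective eq i)

φ₀⁺-entryʳ : ∀ γ δ {f} → lim f ≈ γ ⊕ φ 0 (δ ⁺) → ∀ i → f i ≈ (γ ⊕ ω ^ δ ⊗ o i) ⊕ φ 0 δ
φ₀⁺-entryʳ γ δ eq i = ≈-trans (lim-injective eq i) (φ₀⁺-entry γ δ i)

record Agree (α : Ω) (k : ℕ) (β γ : Ω) (l : ℕ) (δ : Ω) : Set where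
  constructor agree
  field
    index    : k ≡ l
    summand  : α ≈ γ
    argument : β ≈ δ
open Agree

⊕φ-injective-at-𝟎 : ∀ α γ l δ → α ⊕ φ 0 𝟎 ≈ γ ⊕ φ l δ → Agree α 0 𝟎 γ l δ
⊕φ-injective-at-𝟎 α γ zero    𝟎       (⁺≈ α≈γ) = agree refl α≈γ 𝟎≈
⊕φ-injective-at-𝟎 α γ zero    (δ ⁺)   ()
⊕φ-injective-at-𝟎 α γ zero    (lim h) ()
⊕φ-injective-at-𝟎 α γ (suc l) 𝟎       ()
⊕φ-injective-at-𝟎 α γ (suc l) (δ ⁺)   ()
⊕φ-injective-at-𝟎 α γ (suc l) (lim h) ()

mutual
  ⊕φ₀-injective : ∀ α β γ l δ → α ⊕ φ 0 β ≈ γ ⊕ φ l δ → Agree α 0 β γ l δ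
  ⊕φ₀-injective α 𝟎       = ⊕φ-injective-at-𝟎 α
  ⊕φ₀-injective α (β ⁺)   = ⊕φ-injective-at-φ₀⁺ α β
  ⊕φ₀-injective α (lim h) = ⊕φ-injective-at-φ₀lim α h

  ⊕φ-injective-at-φ₀⁺ : ∀ α β γ l δ →
    α ⊕ φ 0 (β ⁺) ≈ γ ⊕ φ l δ → Agree α 0 (β ⁺) γ l δ
  ⊕φ-injective-at-φ₀⁺ α β γ zero 𝟎 ()
  ⊕φ-injective-at-φ₀⁺ α β γ zero (δ ⁺) eq
    with ⊕φ₀-injective α β γ 0 δ (≈-trans (≈-sym (φ₀⁺-entry α β 0)) (φ₀⁺-entryʳ γ δ eq 0))
  ... | agree _ α≈γ β≈δ = agree refl α≈γ (⁺≈ β≈δ)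
  ⊕φ-injective-at-φ₀⁺ α β γ zero (lim h) eq
    with ⊕φ₀-injective α β γ 0 (h 0) (φ₀⁺-entryˡ α β eq 0)
       | ⊕φ₀-injective (α ⊕ ω ^ β ⊗ o 1) β γ 0 (h 1) (φ₀⁺-entryˡ α β eq 1)
  ... | agree _ α≈γ _ | agree _ α⊕ω^β≈γ _
    with () ← φ≢𝟎 0 β (⊕≡𝟎⇒≡𝟎 𝟎 _ (⊕-cycle⇒≡𝟎 𝟎 _ α≈γ α⊕ω^β≈γ))
  ⊕φ-injective-at-φ₀⁺ α β γ (suc l) 𝟎 eq
    with ⊕φ₀-injective (α ⊕ ω ^ β ⊗ o 1) β γ l 𝟎 (φ₀⁺-entryˡ α β eq 1)
       | ⊕φ₀-injective (α ⊕ ω ^ β ⊗ o 2) β γ l (φ l 𝟎) (φ₀⁺-entryˡ α β eq 2)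
  ... | agree _ _ β≈𝟎 | agree _ _ β≈φl𝟎
    with () ← φ≢𝟎 l 𝟎 (≈𝟎⇒≡𝟎 (≈-trans (≈-sym β≈φl𝟎) β≈𝟎))
  ⊕φ-injective-at-φ₀⁺ α β γ (suc l) (δ ⁺) eq
    with ⊕φ₀-injective α β (γ ⊕ φ (suc l) δ) 0 𝟎 (φ₀⁺-entryˡ α β eq 0)
       | ⊕φ₀-injective (α ⊕ ω ^ β ⊗ o 1) β γ l (φ (suc l) δ ⁺) (φ₀⁺-entryˡ α β eq 1)
  ... | agree _ α≈γ⊕φ _ | agree _ α⊕ω^β≈γ _
    with () ← φ≢𝟎 0 β (⊕≡𝟎⇒≡𝟎 𝟎 _ (⊕-cycle⇒≡𝟎 _ _ α≈γ⊕φ α⊕ω^β≈γ))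
  ⊕φ-injective-at-φ₀⁺ α β γ (suc l) (lim h) eq
    with ⊕φ₀-injective α β γ (suc l) (h 0) (φ₀⁺-entryˡ α β eq 0)
  ... | agree () _ _

  ⊕φ-injective-at-φ₀lim : ∀ α h γ l δ →
    α ⊕ φ 0 (lim h) ≈ γ ⊕ φ l δ → Agree α 0 (lim h) γ l δ
  ⊕φ-injective-at-φ₀lim α h γ zero 𝟎 ()
  ⊕φ-injective-at-φ₀lim α h γ zero (δ ⁺) eq
    with ⊕φ₀-injective α (h 0) γ 0 δ (φ₀⁺-entryʳ γ δ eq 0)
       | ⊕φ₀-injective α (h 1) (γ ⊕ ω ^ δ ⊗ o 1) 0 δ (φ₀⁺-entryʳ γ δ eq 1)
  ... | agree _ α≈γ _ | agree _ α≈γ⊕ω^δ _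
    with () ← φ≢𝟎 0 δ (⊕≡𝟎⇒≡𝟎 𝟎 _ (⊕-cycle⇒≡𝟎 𝟎 _ (≈-sym α≈γ) (≈-sym α≈γ⊕ω^δ)))
  ⊕φ-injective-at-φ₀lim α h γ zero (lim h′) eq =
    agree refl (summand (agrees 0)) (lim≈ (λ i → argument (agrees i)))
    where
    agrees : ∀ i → Agree α 0 (h i) γ 0 (h′ i)
    agrees i = ⊕φ₀-injective α (h i) γ 0 (h′ i) (lim-injective eq i)
  ⊕φ-injective-at-φ₀lim α h γ (suc l) 𝟎 eq
    with ⊕φ₀-injective α (h 1) γ l 𝟎 (lim-injective eq 1)
  ... | agree _ α≈γ _
    with () ← φ≢𝟎 0 (h 0) (⊕-cycle⇒≡𝟎 𝟎 _ α≈γ (lim-injective eq 0))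
  ⊕φ-injective-at-φ₀lim α h γ (suc l) (δ ⁺) eq
    with ⊕φ₀-injective α (h 0) (γ ⊕ φ (suc l) δ) 0 𝟎 (lim-injective eq 0)
       | ⊕φ₀-injective α (h 1) γ l (φ (suc l) δ ⁺) (lim-injective eq 1)
  ... | agree _ α≈γ⊕φ _ | agree _ α≈γ _
    with () ← φ≢𝟎 (suc l) δ (⊕-cycle⇒≡𝟎 𝟎 _ (≈-sym α≈γ) (≈-sym α≈γ⊕φ))
  ⊕φ-injective-at-φ₀lim α h γ (suc l) (lim h′) eq
    with ⊕φ₀-injective α (h 0) γ (suc l) (h′ 0) (lim-injective eq 0)
  ... | agree () _ _

mutual
  ⊕φ-injective : ∀ α k β γ l δ → α ⊕ φ k β ≈ γ ⊕ φ l δ → Agree α k β γ l δ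
  ⊕φ-injective α zero    = ⊕φ₀-injective α
  ⊕φ-injective α (suc k) = ⊕φₛ-injective α k

  ⊕φₛ-injective : ∀ α k β γ l δ → α ⊕ φ (suc k) β ≈ γ ⊕ φ l δ → Agree α (suc k) β γ l δ
  ⊕φₛ-injective α k 𝟎       = ⊕φ-injective-at-φₛ𝟎 α k
  ⊕φₛ-injective α k (β ⁺)   = ⊕φ-injective-at-φₛ⁺ α k β
  ⊕φₛ-injective α k (lim h) = ⊕φ-injective-at-φₛlim α k h

  ⊕φ-injective-at-φₛ𝟎 : ∀ α k γ l δ →
    α ⊕ φ (suc k) 𝟎 ≈ γ ⊕ φ l δ → Agree α (suc k) 𝟎 γ l δ
  ⊕φ-injective-at-φₛ𝟎 α k γ zero 𝟎 ()
  ⊕φ-injective-at-φₛ𝟎 α k γ zero (δ ⁺) eq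
    with ⊕φ-injective α k 𝟎 (γ ⊕ ω ^ δ ⊗ o 1) 0 δ (φ₀⁺-entryʳ γ δ eq 1)
       | ⊕φ-injective α k (φ k 𝟎) (γ ⊕ ω ^ δ ⊗ o 2) 0 δ (φ₀⁺-entryʳ γ δ eq 2)
  ... | agree _ _ 𝟎≈δ | agree _ _ φk𝟎≈δ
    with () ← φ≢𝟎 k 𝟎 (≈𝟎⇒≡𝟎 (≈-trans φk𝟎≈δ (≈-sym 𝟎≈δ)))
  ⊕φ-injective-at-φₛ𝟎 α k γ zero (lim h′) eq
    with ⊕φ-injective α k 𝟎 γ 0 (h′ 1) (lim-injective eq 1)
  ... | agree _ α≈γ _
    with () ← φ≢𝟎 0 (h′ 0) (⊕-cycle⇒≡𝟎 𝟎 _ (≈-sym α≈γ) (≈-sym (lim-injective eq 0)))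
  ⊕φ-injective-at-φₛ𝟎 α k γ (suc l) 𝟎 eq
    with ⊕φ-injective α k 𝟎 γ l 𝟎 (lim-injective eq 1)
  ... | agree k≡l _ _ = agree (cong suc k≡l) (lim-injective eq 0) 𝟎≈
  ⊕φ-injective-at-φₛ𝟎 α k γ (suc l) (δ ⁺) eq
    with ⊕φ-injective α k 𝟎 γ l (φ (suc l) δ ⁺) (lim-injective eq 1)
  ... | agree _ α≈γ _
    with () ← ⊕-cycle⇒≡𝟎 𝟎 (φ (suc l) δ ⁺) (≈-sym α≈γ) (≈-sym (lim-injective eq 0))
  ⊕φ-injective-at-φₛ𝟎 α k γ (suc l) (lim h′) eq
    with ⊕φ-injective α k 𝟎 γ (suc l) (h′ 1) (lim-injective eq 1)
  ... | agree _ α≈γ _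
    with () ← φ≢𝟎 (suc l) (h′ 0) (⊕-cycle⇒≡𝟎 𝟎 _ (≈-sym α≈γ) (≈-sym (lim-injective eq 0)))

  ⊕φ-injective-at-φₛ⁺ : ∀ α k β γ l δ →
    α ⊕ φ (suc k) (β ⁺) ≈ γ ⊕ φ l δ → Agree α (suc k) (β ⁺) γ l δ
  ⊕φ-injective-at-φₛ⁺ α k β γ zero 𝟎 ()
  ⊕φ-injective-at-φₛ⁺ α k β γ zero (δ ⁺) eq
    with ⊕φ-injective-at-𝟎 (α ⊕ φ (suc k) β) γ 0 δ (φ₀⁺-entryʳ γ δ eq 0)
       | ⊕φ-injective α k (φ (suc k) β ⁺) (γ ⊕ ω ^ δ ⊗ o 1) 0 δ (φ₀⁺-entryʳ γ δ eq 1)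
  ... | agree _ α⊕φ≈γ _ | agree _ α≈γ⊕ω^δ _
    with () ← φ≢𝟎 (suc k) β (⊕-cycle⇒≡𝟎 _ _ α≈γ⊕ω^δ α⊕φ≈γ)
  ⊕φ-injective-at-φₛ⁺ α k β γ zero (lim h′) eq
    with ⊕φ-injective-at-𝟎 (α ⊕ φ (suc k) β) γ 0 (h′ 0) (lim-injective eq 0)
       | ⊕φ-injective α k (φ (suc k) β ⁺) γ 0 (h′ 1) (lim-injective eq 1)
  ... | agree _ α⊕φ≈γ _ | agree _ α≈γ _
    with () ← φ≢𝟎 (suc k) β (⊕-cycle⇒≡𝟎 𝟎 _ α≈γ α⊕φ≈γ)
  ⊕φ-injective-at-φₛ⁺ α k β γ (suc l) 𝟎 eq
    with ⊕φ-injective α k (φ (suc k) β ⁺) γ l 𝟎 (lim-injective eq 1)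
  ... | agree _ α≈γ _
    with () ← ⊕-cycle⇒≡𝟎 𝟎 (φ (suc k) β ⁺) α≈γ (lim-injective eq 0)
  ⊕φ-injective-at-φₛ⁺ α k β γ (suc l) (δ ⁺) eq
    with ⊕φₛ-injective α k β γ (suc l) δ (⁺-injective (lim-injective eq 0))
  ... | agree k≡l α≈γ β≈δ = agree k≡l α≈γ (⁺≈ β≈δ)
  ⊕φ-injective-at-φₛ⁺ α k β γ (suc l) (lim h′) eq
    with ⊕φ-injective-at-𝟎 (α ⊕ φ (suc k) β) γ (suc l) (h′ 0) (lim-injective eq 0)
  ... | agree () _ _

  ⊕φ-injective-at-φₛlim : ∀ α k h γ l δ →
    α ⊕ φ (suc k) (lim h) ≈ γ ⊕ φ l δ → Agree α (suc k) (lim h) γ l δ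
  ⊕φ-injective-at-φₛlim α k h γ zero 𝟎 ()
  ⊕φ-injective-at-φₛlim α k h γ zero (δ ⁺) eq
    with ⊕φₛ-injective α k (h 0) γ 0 δ (φ₀⁺-entryʳ γ δ eq 0)
  ... | agree () _ _
  ⊕φ-injective-at-φₛlim α k h γ zero (lim h′) eq
    with ⊕φₛ-injective α k (h 0) γ 0 (h′ 0) (lim-injective eq 0)
  ... | agree () _ _
  ⊕φ-injective-at-φₛlim α k h γ (suc l) 𝟎 eq
    with ⊕φₛ-injective α k (h 1) γ l 𝟎 (lim-injective eq 1)
  ... | agree _ α≈γ _
    with () ← φ≢𝟎 (suc k) (h 0) (⊕-cycle⇒≡𝟎 𝟎 _ α≈γ (lim-injective eq 0))
  ⊕φ-injective-at-φₛlim α k h γ (suc l) (δ ⁺) eq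
    with ⊕φₛ-injective α k (h 0) (γ ⊕ φ (suc l) δ) 0 𝟎 (lim-injective eq 0)
  ... | agree () _ _
  ⊕φ-injective-at-φₛlim α k h γ (suc l) (lim h′) eq =
    agree (index (agrees 0)) (summand (agrees 0)) (lim≈ (λ i → argument (agrees i)))
    where
    agrees : ∀ i → Agree α (suc k) (h i) γ (suc l) (h′ i)
    agrees i = ⊕φₛ-injective α k (h i) γ (suc l) (h′ i) (lim-injective eq i)

lemma6p15 : (α β γ δ : Ω) (k l : ℕ) →
    α ⊕ φ k β ≈ γ ⊕ φ l δ → (k ≡ l) × (α ≈ γ) × (β ≈ δ)
lemma6p15 α β γ δ k l eq = index r , summand r , argument r
  where
  r : Agree α k β γ l δ
  r = ⊕φ-injective α k β γ l δ eq
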